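{- Let $G$ be a graph and let $b_1,b_2,b_3\in V(G)$ be mutually distinct. Then there is a proper block $B$ of $G$ with $b_1,b_2,b_3\in B$ if and only if there is a vertex $b_4\in V(G)\setminus\{b_1,b_2,b_3\}$ such that no set $S\subseteq V(G)$ with $|S|\le 2$ separates $\{b_1,b_2,b_3,b_4\}$.
   Context: Graphs are finite, simple, undirected. A set $S\subseteq V(G)$ separates a set $X$ if there are two distinct connected components $C_1,C_2$ of $G\setminus S$ with $X\cap V(C_1)\ne\emptyset$ and $X\cap V(C_2)\ne\emptyset$. For a subgraph $C$, $N_G(C)$ is the set of vertices outside $V(C)$ adjacent to a vertex of $C$. For $X\subseteq V(G)$, the torso $G\llbracket X\rrbracket$ has vertex set $X$, with distinct $v,w\in X$ adjacent iff $vw\in E(G)$ or $v,w\in N_G(C)$ for some connected component $C$ of $G\setminus X$; the adhesion of $X$ is the maximum of $|N_G(C)|$ over connected components $C$ of $G\setminus X$. A graph is 3-connected if it has more than 3 vertices and removing at most 2 vertices leaves it connected. A proper block of $G$ is a set $B\subseteq V(G)$ such that $G\llbracket B\rrbracket$ is 3-connected and $B$ has adhesion at most $2$. -}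

module Defs where

open import Data.Nat using (ℕ; _≤_; _<_)
open import Data.Bool using (Bool; T; false)
open import Data.Fin using (Fin)
open import Data.Fin.Subset using (Subset; _∈_; _∉_; _⊆_; ∣_∣)
open import Data.Product using (Σ; _×_; ∃; ∃-syntax)
open import Data.Sum using (_⊎_)
open import Relation.Nullary using (¬_)
open import Relation.Binary.PropositionalEquality using (_≡_; _≢_)

record Graph (n : ℕ) : Set where
  field
    adj     : Fin n → Fin n → Bool
    adj-sym : ∀ u v → adj u v ≡ adj v u
    adj-irr : ∀ v → adj v v ≡ false

open Graph public

E : ∀ {n} → Graph n → Fin n → Fin n → Set
E G u v = T (adj G u v)

data Walk {n : ℕ} (R : Fin n → Fin n → Set) (A : Fin n → Set) : Fin n → Fin n → Set where
  here : ∀ {u} → A u → Walk R A u u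
  step : ∀ {u v w} → A u → R u v → Walk R A v w → Walk R A u w

SameComp : ∀ {n} → Graph n → Subset n → Fin n → Fin n → Set
SameComp G S u v = Walk (E G) (λ x → x ∉ S) u v

Separates : ∀ {n} → Graph n → Subset n → (Fin n → Set) → Set
Separates G S X =
  ∃[ x ] ∃[ y ] (X x × X y × x ∉ S × y ∉ S × ¬ SameComp G S x y)

-- For c ∉ X, let C be the component of G ∖ X containing c.
-- NbrComp G X c x  means  x ∈ N_G(C): x is outside C and adjacent to a vertex of C.
NbrComp : ∀ {n} → Graph n → Subset n → Fin n → Fin n → Set
NbrComp G X c x = ¬ SameComp G X c x × ∃[ c' ] (SameComp G X c c' × E G c' x)

-- edge relation of the torso G⟦X⟧ (vertex set X; walks will be restricted to X)
TorsoE : ∀ {n} → Graph n → Subset n → Fin n → Fin n → Set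
TorsoE G X v w =
  v ≢ w × (E G v w ⊎ ∃[ c ] (c ∉ X × NbrComp G X c v × NbrComp G X c w))

AtMost2 : ∀ {n} → (Fin n → Set) → Set
AtMost2 P = ∀ x y z → P x → P y → P z → x ≡ y ⊎ x ≡ z ⊎ y ≡ z

AdhesionAtMost2 : ∀ {n} → Graph n → Subset n → Set
AdhesionAtMost2 G X = ∀ c → c ∉ X → AtMost2 (NbrComp G X c)

Torso3Connected : ∀ {n} → Graph n → Subset n → Set
Torso3Connected {n} G X =
  3 < ∣ X ∣ ×
  (∀ (S : Subset n) → S ⊆ X → ∣ S ∣ ≤ 2 →
     ∀ u v → u ∈ X → u ∉ S → v ∈ X → v ∉ S →
       Walk (TorsoE G X) (λ x → x ∈ X × x ∉ S) u v)

ProperBlock : ∀ {n} → Graph n → Subset n → Set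
ProperBlock G B = Torso3Connected G B × AdhesionAtMost2 G B

-- A proper block B is not separated by a set S of at most two vertices. For x, y ∈ B ∖ S
-- delete from the torso, for each r ∈ S, either r itself (r ∈ B) or a neighbour f ∉ {x, y}
-- of the component of G ∖ B containing r: as that component has at most two neighbours, no
-- remaining torso edge passes through it, so a path from x to y in the 3-connected torso
-- minus these at most two vertices lifts to G ∖ S. If the neighbours of such a component are
-- exactly x and y, go through a third vertex w of B instead, deleting y on the way to w and
-- x on the way back.
--
-- Conversely, if no two vertices separate X = {b₁, b₂, b₃, b₄}, let B be the set of vertices
-- that no two vertices separate from X. Paths of G ∖ F between vertices of B project to
-- paths of the torso, which gives 3-connectivity. For a component C of G ∖ B, consider the
-- cuts {a, b} isolating some vertex of C from X; if the side of such a cut is closed under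
-- the edges of C, then every neighbour of C lies in {a, b}, and otherwise the cut can be
-- replaced by one with a strictly larger side. Sides are bounded, so a closed cut exists.

module Submission where

open import Defs
open import Data.Nat using (ℕ; zero; suc; _≤_; _<_; z≤n; s≤s; _+_)
open import Data.Nat.Properties using (≤-trans; ≤-refl; +-mono-≤; +-suc; n≮n; m≤m+n; +-monoʳ-≤; ≤-reflexive; <-≤-trans; n≤1+n)
open import Data.Bool using (true; false; T)
open import Data.Vec using ([]; _∷_; tabulate)
open import Data.Vec.Properties using (lookup∘tabulate; []=⇒lookup; lookup⇒[]=)
open import Data.Fin using (Fin)
open import Data.Fin.Properties using (any?; all?; ¬∀⟶∃¬) renaming (_≟_ to _≟ᶠ_)
open import Data.Fin.Subset using (Subset; _∈_; _∉_; _⊆_; ∣_∣; ⁅_⁆; _∪_) renaming (⊥ to ∅)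
open import Data.Fin.Subset.Properties using (_∈?_; ∉⊥; ∣⊥∣≡0; ∣⁅x⁆∣≡1; x∈⁅x⁆; x∈⁅y⁆⇒x≡y; x∈p∪q⁺; x∈p∪q⁻; p⊆q⇒∣p∣≤∣q∣; p⊂q⇒∣p∣<∣q∣; ∣p∣≤n; ⊥⊆; x≢y⇒x∉⁅y⁆; x∉⁅y⁆⇒x≢y; p⊆p∪q; q⊆p∪q; ∪-comm; ∣p∣≤∣x∷p∣; x∈p⇒∣p-x∣<∣p∣; x∈p∧x≢y⇒x∈p-y)
open import Data.Product using (_×_; _,_; proj₁; proj₂; ∃; ∃-syntax)
open import Data.Sum using (_⊎_; inj₁; inj₂; [_,_]; swap)
open import Data.Empty using (⊥; ⊥-elim)
open import Data.List using (List; []; _∷_; allFin)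
open import Data.List.Relation.Unary.Any using (here; there)
import Data.List.Membership.Propositional as List
open import Data.List.Membership.Propositional.Properties using (∈-allFin)
open import Relation.Nullary using (¬_; Dec; yes; no; does)
open import Relation.Nullary.Decidable using (_×-dec_; _⊎-dec_; _→-dec_; ¬?; T?; map′; dec-true)
open import Relation.Binary.PropositionalEquality using (_≡_; _≢_; refl; sym; trans; subst; ≢-sym)
open import Function.Bundles using (_⇔_; mk⇔)
open import Function.Base using (_∘_)

module Walks {n : ℕ} {R : Fin n → Fin n → Set} where

  start : ∀ {A u v} → Walk R A u v → A u
  start (here a) = a
  start (step a _ _) = a

  end : ∀ {A u v} → Walk R A u v → A v
  end (here a) = a
  end (step _ _ w) = end w

  infixr 5 _++ʷ_
  infixl 6 _∷ʳʷ_

  _++ʷ_ : ∀ {A u v w} → Walk R A u v → Walk R A v w → Walk R A u w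
  here _ ++ʷ q = q
  step a r p ++ʷ q = step a r (p ++ʷ q)

  _∷ʳʷ_ : ∀ {A u v w} → Walk R A u v → R v w × A w → Walk R A u w
  p ∷ʳʷ (r , a) = p ++ʷ step (end p) r (here a)

  weaken : ∀ {A A′ u v} → (∀ {z} → A z → A′ z) → Walk R A u v → Walk R A′ u v
  weaken f (here a) = here (f a)
  weaken f (step a r p) = step (f a) r (weaken f p)

  narrow : ∀ {A A′ u v} → Walk R A u v → (∀ {z} → Walk R A u z → A′ z) → Walk R A′ u v
  narrow (here a) f = here (f (here a))
  narrow (step a r p) f = step (f (here a)) r (narrow p (λ q → f (step a r q)))

  preserves : ∀ {A u v} (P : Fin n → Set) → Walk R A u v → P u →
              (∀ {x y} → P x → A x → R x y → A y → P y) → P v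
  preserves P (here _) pu closed = pu
  preserves P (step a r p) pu closed = preserves P p (closed pu a r (start p)) closed

  reverse : (∀ {x y} → R x y → R y x) → ∀ {A u v} → Walk R A u v → Walk R A v u
  reverse R-sym (here a) = here a
  reverse R-sym (step a r p) = reverse R-sym p ∷ʳʷ (R-sym r , a)

open Walks public

concatMapʷ : ∀ {n} {R R′ : Fin n → Fin n → Set} {A A′ : Fin n → Set} →
  (∀ {z} → A z → A′ z) → (∀ {p q} → A p → A q → R p q → Walk R′ A′ p q) →
  ∀ {u v} → Walk R A u v → Walk R′ A′ u v
concatMapʷ f g (here a) = here (f a)
concatMapʷ f g (step a r p) = g a (start p) r ++ʷ concatMapʷ f g p

module WalkDecidable {n : ℕ} {R : Fin n → Fin n → Set} (R? : ∀ x y → Dec (R x y))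
                     {A : Fin n → Set} (A? : ∀ x → Dec (A x)) where

  -- Induction on the list L of vertices a walk may use: a walk through x ∷ L
  -- either avoids x or splits at its first and last visits to x.
  Through : List (Fin n) → Fin n → Fin n → Set
  Through L = Walk R (λ z → A z × z List.∈ L)

  Into : List (Fin n) → Fin n → Fin n → Set
  Into L x u = A x × (u ≡ x ⊎ ∃[ a ] (Through L u a × R a x))

  OutOf : List (Fin n) → Fin n → Fin n → Set
  OutOf L x v = A x × (v ≡ x ⊎ ∃[ b ] (R x b × Through L b v))

  extend : ∀ {x L u v} → Through L u v → Through (x ∷ L) u v
  extend = weaken (λ (a , m) → a , there m)

  glue : ∀ {x L u v} → Into L x u → OutOf L x v → Through (x ∷ L) u v
  glue {x} {L} {u} {v} (ax , i) (_ , o) = into i ++ʷ outOf o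
    where
      at-x : Through (x ∷ L) x x
      at-x = here (ax , here refl)
      into : u ≡ x ⊎ ∃[ a ] (Through L u a × R a x) → Through (x ∷ L) u x
      into (inj₁ refl) = at-x
      into (inj₂ (a , p , r)) = extend p ∷ʳʷ (r , ax , here refl)
      outOf : v ≡ x ⊎ ∃[ b ] (R x b × Through L b v) → Through (x ∷ L) x v
      outOf (inj₁ refl) = at-x
      outOf (inj₂ (b , r , p)) = step (ax , here refl) r (extend p)

  split : ∀ {x L u v} → Through (x ∷ L) u v → Through L u v ⊎ (Into L x u × OutOf L x v)
  split (here (a , here refl)) = inj₂ ((a , inj₁ refl) , (a , inj₁ refl))
  split (here (a , there m)) = inj₁ (here (a , m))
  split (step (a , mu) r p) with split p | mu
  ... | inj₁ q | here refl = inj₂ ((a , inj₁ refl) , (a , inj₂ (_ , r , q)))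
  ... | inj₁ q | there m = inj₁ (step (a , m) r q)
  ... | inj₂ ((ax , _) , o) | here refl = inj₂ ((ax , inj₁ refl) , o)
  ... | inj₂ ((ax , inj₁ refl) , o) | there m = inj₂ ((ax , inj₂ (_ , here (a , m) , r)) , o)
  ... | inj₂ ((ax , inj₂ (a′ , q , r′)) , o) | there m =
    inj₂ ((ax , inj₂ (a′ , step (a , m) r q , r′)) , o)

  through? : ∀ L u v → Dec (Through L u v)
  through? [] u v = no empty
    where
      empty : ∀ {u v} → ¬ Through [] u v
      empty (here (_ , ()))
      empty (step (_ , ()) _ _)
  through? (x ∷ L) u v =
    map′ [ extend , (λ (i , o) → glue i o) ] split
      (through? L u v ⊎-dec (into? ×-dec outOf?))
    where
      into? : Dec (Into L x u)
      into? = A? x ×-dec ((u ≟ᶠ x) ⊎-dec any? (λ a → through? L u a ×-dec R? a x))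
      outOf? : Dec (OutOf L x v)
      outOf? = A? x ×-dec ((v ≟ᶠ x) ⊎-dec any? (λ b → R? x b ×-dec through? L b v))

  walk? : ∀ u v → Dec (Walk R A u v)
  walk? u v = map′ (weaken proj₁) (weaken (λ {z} a → a , ∈-allFin z)) (through? (allFin n) u v)

∣p∪q∣≤∣p∣+∣q∣ : ∀ {n} (p q : Subset n) → ∣ p ∪ q ∣ ≤ ∣ p ∣ + ∣ q ∣
∣p∪q∣≤∣p∣+∣q∣ [] [] = z≤n
∣p∪q∣≤∣p∣+∣q∣ (true ∷ p) (t ∷ q) =
  s≤s (≤-trans (∣p∪q∣≤∣p∣+∣q∣ p q) (+-mono-≤ (≤-refl {∣ p ∣}) (∣p∣≤∣x∷p∣ t q)))
∣p∪q∣≤∣p∣+∣q∣ (false ∷ p) (true ∷ q) rewrite +-suc ∣ p ∣ ∣ q ∣ = s≤s (∣p∪q∣≤∣p∣+∣q∣ p q)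
∣p∪q∣≤∣p∣+∣q∣ (false ∷ p) (false ∷ q) = ∣p∪q∣≤∣p∣+∣q∣ p q

∣∅∣≤1 : ∀ {n} → ∣ ∅ {n} ∣ ≤ 1
∣∅∣≤1 {n} rewrite ∣⊥∣≡0 n = z≤n

∣⁅x⁆∣≤1 : ∀ {n} (x : Fin n) → ∣ ⁅ x ⁆ ∣ ≤ 1
∣⁅x⁆∣≤1 x rewrite ∣⁅x⁆∣≡1 x = ≤-refl

∣p∪q∣≤2 : ∀ {n} (p q : Subset n) → ∣ p ∣ ≤ 1 → ∣ q ∣ ≤ 1 → ∣ p ∪ q ∣ ≤ 2
∣p∪q∣≤2 p q p≤1 q≤1 = ≤-trans (∣p∪q∣≤∣p∣+∣q∣ p q) (+-mono-≤ p≤1 q≤1)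

∉-∪ : ∀ {n} {p q : Subset n} {x} → x ∉ p → x ∉ q → x ∉ p ∪ q
∉-∪ {p = p} {q} x∉p x∉q x∈p∪q = [ x∉p , x∉q ] (x∈p∪q⁻ p q x∈p∪q)

∪-⊆ : ∀ {n} {p q r : Subset n} → p ⊆ r → q ⊆ r → p ∪ q ⊆ r
∪-⊆ {p = p} {q} p⊆r q⊆r x∈p∪q = [ p⊆r , q⊆r ] (x∈p∪q⁻ p q x∈p∪q)

⁅x⁆⊆p : ∀ {n} {x : Fin n} {p} → x ∈ p → ⁅ x ⁆ ⊆ p
⁅x⁆⊆p {x = x} x∈p z∈x rewrite x∈⁅y⁆⇒x≡y x z∈x = x∈p

pair : ∀ {n} → Fin n → Fin n → Subset n
pair a b = ⁅ a ⁆ ∪ ⁅ b ⁆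

module _ {n : ℕ} {a b z : Fin n} where

  ∈-pair⁻ : z ∈ pair a b → z ≡ a ⊎ z ≡ b
  ∈-pair⁻ z∈ab with x∈p∪q⁻ ⁅ a ⁆ ⁅ b ⁆ z∈ab
  ... | inj₁ z∈a = inj₁ (x∈⁅y⁆⇒x≡y a z∈a)
  ... | inj₂ z∈b = inj₂ (x∈⁅y⁆⇒x≡y b z∈b)

  ∈-pair⁺ : z ≡ a ⊎ z ≡ b → z ∈ pair a b
  ∈-pair⁺ (inj₁ refl) = x∈p∪q⁺ (inj₁ (x∈⁅x⁆ z))
  ∈-pair⁺ (inj₂ refl) = x∈p∪q⁺ (inj₂ (x∈⁅x⁆ z))

  ∉-pair : z ≢ a → z ≢ b → z ∉ pair a b
  ∉-pair z≢a z≢b z∈ab = [ z≢a , z≢b ] (∈-pair⁻ z∈ab)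

pair-⊆ : ∀ {n} {a b : Fin n} {r} → a ∈ r → b ∈ r → pair a b ⊆ r
pair-⊆ a∈r b∈r = ∪-⊆ (⁅x⁆⊆p a∈r) (⁅x⁆⊆p b∈r)

∈-pair⇒other : ∀ {n} {a b z : Fin n} → z ∈ pair a b → ∃[ r ] (r ∈ pair a b × pair a b ⊆ pair z r)
∈-pair⇒other z∈ab with ∈-pair⁻ z∈ab
... | inj₁ refl = _ , ∈-pair⁺ (inj₂ refl) , λ w∈ → w∈
... | inj₂ refl = _ , ∈-pair⁺ (inj₁ refl) , pair-⊆ (∈-pair⁺ (inj₂ refl)) (∈-pair⁺ (inj₁ refl))

∣pair∣≤2 : ∀ {n} (a b : Fin n) → ∣ pair a b ∣ ≤ 2
∣pair∣≤2 a b = ∣p∪q∣≤2 ⁅ a ⁆ ⁅ b ⁆ (∣⁅x⁆∣≤1 a) (∣⁅x⁆∣≤1 b)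

module _ {n : ℕ} where

  1≤∣p∣ : ∀ {p : Subset n} {x} → x ∈ p → 1 ≤ ∣ p ∣
  1≤∣p∣ x∈p = ≤-trans (s≤s z≤n) (x∈p⇒∣p-x∣<∣p∣ x∈p)

  2≤∣p∣ : ∀ {p : Subset n} {x y} → x ∈ p → y ∈ p → x ≢ y → 2 ≤ ∣ p ∣
  2≤∣p∣ x∈p y∈p x≢y =
    ≤-trans (s≤s (1≤∣p∣ (x∈p∧x≢y⇒x∈p-y y∈p (≢-sym x≢y)))) (x∈p⇒∣p-x∣<∣p∣ x∈p)

  3≤∣p∣ : ∀ {p : Subset n} {x y z} → x ∈ p → y ∈ p → z ∈ p →
          x ≢ y → x ≢ z → y ≢ z → 3 ≤ ∣ p ∣
  3≤∣p∣ x∈p y∈p z∈p x≢y x≢z y≢z =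
    ≤-trans (s≤s (2≤∣p∣ (x∈p∧x≢y⇒x∈p-y y∈p (≢-sym x≢y)) (x∈p∧x≢y⇒x∈p-y z∈p (≢-sym x≢z)) y≢z))
            (x∈p⇒∣p-x∣<∣p∣ x∈p)

  4≤∣p∣ : ∀ {p : Subset n} {x y z w} → x ∈ p → y ∈ p → z ∈ p → w ∈ p →
          x ≢ y → x ≢ z → x ≢ w → y ≢ z → y ≢ w → z ≢ w → 4 ≤ ∣ p ∣
  4≤∣p∣ x∈p y∈p z∈p w∈p x≢y x≢z x≢w y≢z y≢w z≢w =
    ≤-trans (s≤s (3≤∣p∣ (x∈p∧x≢y⇒x∈p-y y∈p (≢-sym x≢y)) (x∈p∧x≢y⇒x∈p-y z∈p (≢-sym x≢z))
                        (x∈p∧x≢y⇒x∈p-y w∈p (≢-sym x≢w)) y≢z y≢w z≢w))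
            (x∈p⇒∣p-x∣<∣p∣ x∈p)

∣p∣≤2⇒⊆pair : ∀ {n} (p : Subset n) → ∣ p ∣ ≤ 2 → (d : Fin n) →
              ∃[ s ] ∃[ t ] (p ⊆ pair s t × pair s t ⊆ p ∪ ⁅ d ⁆)
∣p∣≤2⇒⊆pair p ∣p∣≤2 d with any? (_∈? p)
... | no p-empty = d , d , (λ z∈p → ⊥-elim (p-empty (_ , z∈p))) , pair-⊆ d∈ d∈
  where
    d∈ : d ∈ p ∪ ⁅ d ⁆
    d∈ = x∈p∪q⁺ (inj₂ (x∈⁅x⁆ d))
... | yes (s , s∈p) with any? (λ z → z ∈? p ×-dec ¬? (z ≟ᶠ s))
...   | no only-s = s , d , p⊆sd , pair-⊆ (x∈p∪q⁺ (inj₁ s∈p)) (x∈p∪q⁺ (inj₂ (x∈⁅x⁆ d)))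
  where
    p⊆sd : p ⊆ pair s d
    p⊆sd {z} z∈p with z ≟ᶠ s
    ... | yes z≡s = ∈-pair⁺ (inj₁ z≡s)
    ... | no z≢s = ⊥-elim (only-s (z , z∈p , z≢s))
...   | yes (t , t∈p , t≢s) = s , t , p⊆st , pair-⊆ (x∈p∪q⁺ (inj₁ s∈p)) (x∈p∪q⁺ (inj₁ t∈p))
  where
    p⊆st : p ⊆ pair s t
    p⊆st {z} z∈p with z ≟ᶠ s | z ≟ᶠ t
    ... | yes z≡s | _ = ∈-pair⁺ (inj₁ z≡s)
    ... | no _ | yes z≡t = ∈-pair⁺ (inj₂ z≡t)
    ... | no z≢s | no z≢t =
      ⊥-elim (n≮n 2 (≤-trans (3≤∣p∣ s∈p t∈p z∈p (≢-sym t≢s) (≢-sym z≢s) (≢-sym z≢t)) ∣p∣≤2))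

∣p∣<∣q∣⇒∃∈q∖p : ∀ {n} (p q : Subset n) → ∣ p ∣ < ∣ q ∣ → ∃[ x ] (x ∈ q × x ∉ p)
∣p∣<∣q∣⇒∃∈q∖p p q ∣p∣<∣q∣ with any? (λ x → x ∈? q ×-dec ¬? (x ∈? p))
... | yes found = found
... | no none = ⊥-elim (n≮n ∣ p ∣ (<-≤-trans ∣p∣<∣q∣ (p⊆q⇒∣p∣≤∣q∣ q⊆p)))
  where
    q⊆p : q ⊆ p
    q⊆p {x} x∈q with x ∈? p
    ... | yes x∈p = x∈p
    ... | no x∉p = ⊥-elim (none (x , x∈q , x∉p))

∣pair∪q∣≤3 : ∀ {n} (a b : Fin n) {q} → ∣ q ∣ ≤ 1 → ∣ pair a b ∪ q ∣ ≤ 3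
∣pair∪q∣≤3 a b {q} ∣q∣≤1 = ≤-trans (∣p∪q∣≤∣p∣+∣q∣ (pair a b) q) (+-mono-≤ (∣pair∣≤2 a b) ∣q∣≤1)

3<∣p∣⇒∃-avoiding : ∀ {n} {p C : Subset n} → 3 < ∣ p ∣ → ∣ C ∣ ≤ 1 → ∀ a b →
                   ∃[ d ] (d ∈ p × d ≢ a × d ≢ b × d ∉ C)
3<∣p∣⇒∃-avoiding {p = p} {C} 3<∣p∣ ∣C∣≤1 a b
  with ∣p∣<∣q∣⇒∃∈q∖p (pair a b ∪ C) p (≤-trans (s≤s (∣pair∪q∣≤3 a b ∣C∣≤1)) 3<∣p∣)
... | d , d∈p , d∉abC =
  d , d∈p , (λ { refl → d∉abC (x∈p∪q⁺ (inj₁ (∈-pair⁺ (inj₁ refl)))) })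
          , (λ { refl → d∉abC (x∈p∪q⁺ (inj₁ (∈-pair⁺ (inj₂ refl)))) })
          , (λ d∈C → d∉abC (x∈p∪q⁺ (inj₂ d∈C)))

module _ {n : ℕ} {P : Fin n → Set} (P? : ∀ x → Dec (P x)) where

  subsetOf : Subset n
  subsetOf = tabulate (λ x → does (P? x))

  ∈-subsetOf⁺ : ∀ {x} → P x → x ∈ subsetOf
  ∈-subsetOf⁺ {x} px = lookup⇒[]= x subsetOf (trans (lookup∘tabulate _ x) (dec-true (P? x) px))

  ∈-subsetOf⁻ : ∀ {x} → x ∈ subsetOf → P x
  ∈-subsetOf⁻ {x} x∈ with P? x | trans (sym (lookup∘tabulate _ x)) ([]=⇒lookup x∈)
  ... | yes px | _ = px
  ... | no _ | ()

bounded-ascent : {I : Set} (size : I → ℕ) (n : ℕ) → (∀ i → size i ≤ n) →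
                 (Done : I → Set) → (∀ i → Done i ⊎ ∃[ j ] (size i < size j)) →
                 I → ∃ Done
bounded-ascent {I} size n bound Done done-or-grow i₀ = go n i₀ (m≤m+n n (size i₀))
  where
    go : (fuel : ℕ) (i : I) → n ≤ fuel + size i → ∃ Done
    go fuel i n≤ with done-or-grow i
    ... | inj₁ done = i , done
    go zero i n≤ | inj₂ (j , i<j) = ⊥-elim (n≮n n (≤-trans (s≤s n≤) (≤-trans i<j (bound j))))
    go (suc fuel) i n≤ | inj₂ (j , i<j) =
      go fuel j (≤-trans n≤ (≤-trans (≤-reflexive (sym (+-suc fuel (size i)))) (+-monoʳ-≤ fuel i<j)))

Separates-mono : ∀ {n} (G : Graph n) (S : Subset n) {P Q : Fin n → Set} →
                 (∀ {x} → P x → Q x) → Separates G S P → Separates G S Q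
Separates-mono G S P⊆Q (x , y , px , py , x∉S , y∉S , apart) =
  x , y , P⊆Q px , P⊆Q py , x∉S , y∉S , apart

module GraphFacts {n : ℕ} (G : Graph n) where

  E-sym : ∀ {u v} → E G u v → E G v u
  E-sym {u} {v} = subst T (adj-sym G u v)

  E-irrefl : ∀ {v} → ¬ E G v v
  E-irrefl {v} = subst T (adj-irr G v)

  E? : ∀ u v → Dec (E G u v)
  E? u v = T? (adj G u v)

  sameComp-sym : ∀ {S u v} → SameComp G S u v → SameComp G S v u
  sameComp-sym = reverse E-sym

  sameComp-anti : ∀ {S S′ u v} → S ⊆ S′ → SameComp G S′ u v → SameComp G S u v
  sameComp-anti S⊆S′ = weaken (λ z∉S′ z∈S → z∉S′ (S⊆S′ z∈S))

  sameComp? : ∀ S u v → Dec (SameComp G S u v)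
  sameComp? S = WalkDecidable.walk? E? (λ x → ¬? (x ∈? S))

  nbrComp? : ∀ X c x → Dec (NbrComp G X c x)
  nbrComp? X c x = ¬? (sameComp? X c x) ×-dec any? (λ c′ → sameComp? X c c′ ×-dec E? c′ x)

  nbrComp-∈ : ∀ {X c x} → NbrComp G X c x → x ∈ X
  nbrComp-∈ {X} {c} {x} (apart , c′ , c~c′ , e) with x ∈? X
  ... | yes x∈X = x∈X
  ... | no x∉X = ⊥-elim (apart (c~c′ ∷ʳʷ (e , x∉X)))

  nbrComp-transport : ∀ {X c d x} → SameComp G X c d → NbrComp G X c x → NbrComp G X d x
  nbrComp-transport c~d (apart , c′ , c~c′ , e) =
    (λ d~x → apart (c~d ++ʷ d~x)) , c′ , sameComp-sym c~d ++ʷ c~c′ , e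

  module _ (X F : Subset n) where

    TorsoWalk : Fin n → Fin n → Set
    TorsoWalk = Walk (TorsoE G X) (λ z → z ∈ X × z ∉ F)

    -- p is the last vertex of X passed; the current vertex w is p itself or
    -- lies in a component of G ∖ X having p as a neighbour.
    Behind : Fin n → Fin n → Set
    Behind p w = p ≡ w ⊎ (w ∉ X × NbrComp G X w p)

    toTorso : ∀ {p w v} → SameComp G F w v → v ∈ X → p ∈ X → p ∉ F → Behind p w → TorsoWalk p v
    toTorso (here _) v∈X p∈X p∉F (inj₁ refl) = here (p∈X , p∉F)
    toTorso (here _) v∈X p∈X p∉F (inj₂ (v∉X , _)) = ⊥-elim (v∉X v∈X)
    toTorso {p} (step {v = w′} _ e rest) v∈X p∈X p∉F (inj₁ refl) with w′ ∈? X
    ... | yes w′∈X = step (p∈X , p∉F) ((λ { refl → E-irrefl e }) , inj₁ e)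
                          (toTorso rest v∈X w′∈X (start rest) (inj₁ refl))
    ... | no w′∉X = toTorso rest v∈X p∈X p∉F
                      (inj₂ (w′∉X , (λ w′~p → end w′~p p∈X) , w′ , here w′∉X , E-sym e))
    toTorso {p} (step {u = w} {v = w′} _ e rest) v∈X p∈X p∉F (inj₂ (w∉X , Nwp)) with w′ ∈? X
    ... | no w′∉X =
      toTorso rest v∈X p∈X p∉F (inj₂ (w′∉X , nbrComp-transport (step w∉X e (here w′∉X)) Nwp))
    ... | yes w′∈X with p ≟ᶠ w′
    ...   | yes refl = toTorso rest v∈X p∈X p∉F (inj₁ refl)
    ...   | no p≢w′ = step (p∈X , p∉F) (p≢w′ , inj₂ (w , w∉X , Nwp , Nww′))
                           (toTorso rest v∈X w′∈X (start rest) (inj₁ refl))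
      where
        Nww′ : NbrComp G X w w′
        Nww′ = (λ w~w′ → end w~w′ w′∈X) , w , here w∉X , e

    sameComp⇒torsoWalk : ∀ {u v} → u ∈ X → v ∈ X → SameComp G F u v → TorsoWalk u v
    sameComp⇒torsoWalk u∈X v∈X u~v = toTorso u~v v∈X u∈X (start u~v) (inj₁ refl)

module ProperBlockInseparable {n : ℕ} (G : Graph n) (B : Subset n) (block : ProperBlock G B) where
  open GraphFacts G

  module _ (S : Subset n) where

    torsoEdge⇒sameComp : ∀ {p q} → p ∉ S → q ∉ S → TorsoE G B p q →
      (∀ {r} → r ∈ S → r ∉ B → NbrComp G B r p → NbrComp G B r q → ⊥) → SameComp G S p q
    torsoEdge⇒sameComp p∉S q∉S (_ , inj₁ e) _ = step p∉S e (here q∉S)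
    torsoEdge⇒sameComp p∉S q∉S
      (_ , inj₂ (c , c∉B , Np@(_ , c₁ , c~c₁ , e₁) , Nq@(_ , c₂ , c~c₂ , e₂))) no-cut
      with any? (λ r → r ∈? S ×-dec sameComp? B c r)
    ... | yes (r , r∈S , c~r) =
      ⊥-elim (no-cut r∈S (end c~r) (nbrComp-transport c~r Np) (nbrComp-transport c~r Nq))
    ... | no S-misses-comp =
      step p∉S (E-sym e₁) (narrow (sameComp-sym c~c₁ ++ʷ c~c₂) avoids-S ∷ʳʷ (e₂ , q∉S))
      where
        avoids-S : ∀ {z} → SameComp G B c₁ z → z ∉ S
        avoids-S c₁~z z∈S = S-misses-comp (_ , z∈S , c~c₁ ++ʷ c₁~z)

    -- Deleting F from the torso removes every torso edge that could need r.
    Guards : Subset n → Fin n → Set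
    Guards F r = r ∈ S →
      (r ∈ B → r ∈ F) ×
      (r ∉ B → ∀ {p q} → p ≢ q → NbrComp G B r p → NbrComp G B r q → p ∈ F ⊎ q ∈ F)

    torsoWalk⇒sameComp : ∀ {F u v} → (∀ r → Guards F r) → TorsoWalk B F u v → SameComp G S u v
    torsoWalk⇒sameComp {F} guards = concatMapʷ avoids-S lift-edge
      where
        avoids-S : ∀ {z} → z ∈ B × z ∉ F → z ∉ S
        avoids-S (z∈B , z∉F) z∈S = z∉F (proj₁ (guards _ z∈S) z∈B)
        lift-edge : ∀ {p q} → p ∈ B × p ∉ F → q ∈ B × q ∉ F → TorsoE G B p q → SameComp G S p q
        lift-edge p@(_ , p∉F) q@(_ , q∉F) pq =
          torsoEdge⇒sameComp (avoids-S p) (avoids-S q) pq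
            (λ r∈S r∉B Np Nq → [ p∉F , q∉F ] (proj₂ (guards _ r∈S) r∉B (proj₁ pq) Np Nq))

    connected-avoiding : ∀ F → F ⊆ B → ∣ F ∣ ≤ 2 → (∀ r → Guards F r) →
                         ∀ {u v} → u ∈ B → u ∉ F → v ∈ B → v ∉ F → SameComp G S u v
    connected-avoiding F F⊆B ∣F∣≤2 guards u∈B u∉F v∈B v∉F =
      torsoWalk⇒sameComp guards (proj₂ (proj₁ block) F F⊆B ∣F∣≤2 _ _ u∈B u∉F v∈B v∉F)

    guards-all : ∀ {s t F} → S ⊆ pair s t → Guards F s → Guards F t → ∀ r → Guards F r
    guards-all S⊆st gs gt r r∈S with ∈-pair⁻ (S⊆st r∈S)
    ... | inj₁ refl = gs r∈S
    ... | inj₂ refl = gt r∈S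

    module _ {x y : Fin n} (x∈B : x ∈ B) (y∈B : y ∈ B) (x∉S : x ∉ S) (y∉S : y ∉ S) where

      record Admissible (C : Subset n) : Set where
        field
          size≤1 : ∣ C ∣ ≤ 1
          ⊆B : C ⊆ B
          x∉ : x ∉ C
          y∉ : y ∉ C
      open Admissible

      ∅-admissible : Admissible ∅
      ∅-admissible = record { size≤1 = ∣∅∣≤1 {n} ; ⊆B = ⊥⊆ ; x∉ = ∉⊥ ; y∉ = ∉⊥ }

      Guarded : Fin n → Set
      Guarded r = ∃[ C ] (Admissible C × (∀ {F} → C ⊆ F → Guards F r))

      GuardedByEnds : Fin n → Set
      GuardedByEnds r = ∀ {F} → x ∈ F ⊎ y ∈ F → Guards F r

      classify : ∀ r → Guarded r ⊎ GuardedByEnds r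
      classify r with r ∈? S
      ... | no r∉S = inj₁ (∅ , ∅-admissible , λ _ r∈S → ⊥-elim (r∉S r∈S))
      ... | yes r∈S with r ∈? B
      ...   | yes r∈B =
        inj₁ (⁅ r ⁆ , admissible , λ r⊆F _ → (λ _ → r⊆F (x∈⁅x⁆ r)) , λ r∉B → ⊥-elim (r∉B r∈B))
        where
          admissible : Admissible ⁅ r ⁆
          admissible = record
            { size≤1 = ∣⁅x⁆∣≤1 r ; ⊆B = ⁅x⁆⊆p r∈B
            ; x∉ = x≢y⇒x∉⁅y⁆ (λ { refl → x∉S r∈S }) ; y∉ = x≢y⇒x∉⁅y⁆ (λ { refl → y∉S r∈S }) }
      ...   | no r∉B with any? (λ f → nbrComp? B r f ×-dec ¬? (f ≟ᶠ x) ×-dec ¬? (f ≟ᶠ y))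
      ...     | yes (f , Nf , f≢x , f≢y) = inj₁ (⁅ f ⁆ , admissible , guards)
        where
          admissible : Admissible ⁅ f ⁆
          admissible = record
            { size≤1 = ∣⁅x⁆∣≤1 f ; ⊆B = ⁅x⁆⊆p (nbrComp-∈ Nf)
            ; x∉ = x≢y⇒x∉⁅y⁆ (≢-sym f≢x) ; y∉ = x≢y⇒x∉⁅y⁆ (≢-sym f≢y) }
          -- The component of r has at most two neighbours, one of which is f.
          guards : ∀ {F} → ⁅ f ⁆ ⊆ F → Guards F r
          guards f⊆F _ = (λ r∈B → ⊥-elim (r∉B r∈B)) , λ _ {p} {q} p≢q Np Nq →
            case-f (proj₂ block r r∉B p q f Np Nq Nf) p≢q f⊆F
            where
              case-f : ∀ {F p q} → p ≡ q ⊎ p ≡ f ⊎ q ≡ f → p ≢ q → ⁅ f ⁆ ⊆ F → p ∈ F ⊎ q ∈ F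
              case-f (inj₁ p≡q) p≢q _ = ⊥-elim (p≢q p≡q)
              case-f (inj₂ (inj₁ refl)) _ f⊆F = inj₁ (f⊆F (x∈⁅x⁆ f))
              case-f (inj₂ (inj₂ refl)) _ f⊆F = inj₂ (f⊆F (x∈⁅x⁆ f))
      ...     | no only-ends = inj₂ (λ ends∩F _ → (λ r∈B → ⊥-elim (r∉B r∈B)) , λ _ p≢q Np Nq →
                                      one-in-F (end-of Np) (end-of Nq) p≢q ends∩F)
        where
          end-of : ∀ {f} → NbrComp G B r f → f ≡ x ⊎ f ≡ y
          end-of {f} Nf with f ≟ᶠ x | f ≟ᶠ y
          ... | yes f≡x | _ = inj₁ f≡x
          ... | no _ | yes f≡y = inj₂ f≡y
          ... | no f≢x | no f≢y = ⊥-elim (only-ends (f , Nf , f≢x , f≢y))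
          one-in-F : ∀ {p q F} → p ≡ x ⊎ p ≡ y → q ≡ x ⊎ q ≡ y → p ≢ q → x ∈ F ⊎ y ∈ F → p ∈ F ⊎ q ∈ F
          one-in-F (inj₁ refl) (inj₁ refl) p≢q _ = ⊥-elim (p≢q refl)
          one-in-F (inj₂ refl) (inj₂ refl) p≢q _ = ⊥-elim (p≢q refl)
          one-in-F (inj₁ refl) (inj₂ refl) _ x∈F⊎y∈F = x∈F⊎y∈F
          one-in-F (inj₂ refl) (inj₁ refl) _ x∈F⊎y∈F = swap x∈F⊎y∈F

      via-guards : ∀ {s t} → S ⊆ pair s t → Guarded s → Guarded t → SameComp G S x y
      via-guards S⊆st (Cs , as , gs) (Ct , at , gt) =
        connected-avoiding (Cs ∪ Ct) (∪-⊆ (⊆B as) (⊆B at)) (∣p∪q∣≤2 Cs Ct (size≤1 as) (size≤1 at))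
          (guards-all S⊆st (gs (p⊆p∪q Ct)) (gt (q⊆p∪q Cs Ct)))
          x∈B (∉-∪ (x∉ as) (x∉ at)) y∈B (∉-∪ (y∉ as) (y∉ at))

      via-detour : x ≢ y → ∀ {C} → Admissible C →
                   (∀ {F} → C ⊆ F → x ∈ F ⊎ y ∈ F → ∀ r → Guards F r) → SameComp G S x y
      via-detour x≢y {C} adm guards with 3<∣p∣⇒∃-avoiding (proj₁ (proj₁ block)) (size≤1 adm) x y
      ... | w , w∈B , w≢x , w≢y , w∉C = x~w ++ʷ w~y
        where
          x~w : SameComp G S x w
          x~w = connected-avoiding (C ∪ ⁅ y ⁆) (∪-⊆ (⊆B adm) (⁅x⁆⊆p y∈B))
                  (∣p∪q∣≤2 C ⁅ y ⁆ (size≤1 adm) (∣⁅x⁆∣≤1 y))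
                  (guards (p⊆p∪q ⁅ y ⁆) (inj₂ (x∈p∪q⁺ (inj₂ (x∈⁅x⁆ y)))))
                  x∈B (∉-∪ (x∉ adm) (x≢y⇒x∉⁅y⁆ x≢y)) w∈B (∉-∪ w∉C (x≢y⇒x∉⁅y⁆ w≢y))
          w~y : SameComp G S w y
          w~y = connected-avoiding (C ∪ ⁅ x ⁆) (∪-⊆ (⊆B adm) (⁅x⁆⊆p x∈B))
                  (∣p∪q∣≤2 C ⁅ x ⁆ (size≤1 adm) (∣⁅x⁆∣≤1 x))
                  (guards (p⊆p∪q ⁅ x ⁆) (inj₁ (x∈p∪q⁺ (inj₂ (x∈⁅x⁆ x)))))
                  w∈B (∉-∪ w∉C (x≢y⇒x∉⁅y⁆ w≢x)) y∈B (∉-∪ (y∉ adm) (x≢y⇒x∉⁅y⁆ (≢-sym x≢y)))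

      connected : ∣ S ∣ ≤ 2 → SameComp G S x y
      connected ∣S∣≤2 with x ≟ᶠ y | ∣p∣≤2⇒⊆pair S ∣S∣≤2 x
      ... | yes refl | _ = here x∉S
      ... | no x≢y | s , t , S⊆st , _ with classify s | classify t
      ...   | inj₁ gs | inj₁ gt = via-guards S⊆st gs gt
      ...   | inj₁ (C , adm , gs) | inj₂ ft = via-detour x≢y adm (λ C⊆F h → guards-all S⊆st (gs C⊆F) (ft h))
      ...   | inj₂ fs | inj₁ (C , adm , gt) = via-detour x≢y adm (λ C⊆F h → guards-all S⊆st (fs h) (gt C⊆F))
      ...   | inj₂ fs | inj₂ ft = via-detour x≢y ∅-admissible (λ _ h → guards-all S⊆st (fs h) (ft h))

  inseparable : ∀ S → ∣ S ∣ ≤ 2 → ¬ Separates G S (_∈ B)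
  inseparable S ∣S∣≤2 (x , y , x∈B , y∈B , x∉S , y∉S , apart) =
    apart (connected S x∈B y∈B x∉S y∉S ∣S∣≤2)

module InseparableSetBlock {n : ℕ} (G : Graph n) (X : Subset n) (X-large : 3 < ∣ X ∣)
                           (X-inseparable : ∀ S → ∣ S ∣ ≤ 2 → ¬ Separates G S (_∈ X)) where
  open GraphFacts G

  Reaches : Subset n → Fin n → Set
  Reaches S v = ∃[ x ] (x ∈ X × x ∉ S × SameComp G S v x)

  reaches? : ∀ S v → Dec (Reaches S v)
  reaches? S v = any? (λ x → x ∈? X ×-dec ¬? (x ∈? S) ×-dec sameComp? S v x)

  Attached : Fin n → Set
  Attached v = ∀ a b → v ∉ pair a b → Reaches (pair a b) v

  attached? : ∀ v → Dec (Attached v)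
  attached? v = all? (λ a → all? (λ b → ¬? (v ∈? pair a b) →-dec reaches? (pair a b) v))

  B : Subset n
  B = subsetOf attached?

  ∉B⇒detached : ∀ {v} → v ∉ B → ∃[ a ] ∃[ b ] (v ∉ pair a b × ¬ Reaches (pair a b) v)
  ∉B⇒detached {v} v∉B
    with ¬∀⟶∃¬ n _ (λ a → all? (λ b → ¬? (v ∈? pair a b) →-dec reaches? (pair a b) v))
                   (λ attached → v∉B (∈-subsetOf⁺ attached? attached))
  ... | a , ¬∀b with ¬∀⟶∃¬ n _ (λ b → ¬? (v ∈? pair a b) →-dec reaches? (pair a b) v) ¬∀b
  ...   | b , ¬reaches with v ∈? pair a b
  ...     | yes v∈ab = ⊥-elim (¬reaches (λ v∉ab → ⊥-elim (v∉ab v∈ab)))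
  ...     | no v∉ab = a , b , v∉ab , λ reaches → ¬reaches (λ _ → reaches)

  X⊆B : X ⊆ B
  X⊆B x∈X = ∈-subsetOf⁺ attached? (λ a b x∉ab → _ , x∈X , x∉ab , here x∉ab)

  X-connected : ∀ {S x y} → ∣ S ∣ ≤ 2 → x ∈ X → y ∈ X → x ∉ S → y ∉ S → SameComp G S x y
  X-connected {S} {x} {y} ∣S∣≤2 x∈X y∈X x∉S y∉S with sameComp? S x y
  ... | yes x~y = x~y
  ... | no x≁y = ⊥-elim (X-inseparable S ∣S∣≤2 (x , y , x∈X , y∈X , x∉S , y∉S , x≁y))

  X-avoiding : ∀ u v → ∃[ d ] (d ∈ X × d ∉ pair u v)
  X-avoiding u v = ∣p∣<∣q∣⇒∃∈q∖p (pair u v) X (≤-trans (s≤s (∣pair∣≤2 u v)) (≤-trans (n≤1+n 3) X-large))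

  torso-3-connected : Torso3Connected G B
  torso-3-connected = ≤-trans X-large (p⊆q⇒∣p∣≤∣q∣ X⊆B) , connected
    where
      connected : ∀ F → F ⊆ B → ∣ F ∣ ≤ 2 → ∀ u v → u ∈ B → u ∉ F → v ∈ B → v ∉ F → TorsoWalk B F u v
      connected F F⊆B ∣F∣≤2 u v u∈B u∉F v∈B v∉F with X-avoiding u v
      ... | d , d∈X , d∉uv with ∣p∣≤2⇒⊆pair F ∣F∣≤2 d
      ...   | s , t , F⊆st , st⊆F∪d = sameComp⇒torsoWalk B F u∈B v∈B (sameComp-anti F⊆st u~v)
        where
          outside-st : ∀ {z} → z ∉ F → z ∈ pair u v → z ∉ pair s t
          outside-st z∉F z∈uv z∈st with x∈p∪q⁻ F ⁅ d ⁆ (st⊆F∪d z∈st)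
          ... | inj₁ z∈F = z∉F z∈F
          ... | inj₂ z∈d rewrite x∈⁅y⁆⇒x≡y d z∈d = d∉uv z∈uv
          u∉st : u ∉ pair s t
          u∉st = outside-st u∉F (∈-pair⁺ (inj₁ refl))
          v∉st : v ∉ pair s t
          v∉st = outside-st v∉F (∈-pair⁺ (inj₂ refl))
          u~v : SameComp G (pair s t) u v
          u~v with ∈-subsetOf⁻ attached? u∈B s t u∉st | ∈-subsetOf⁻ attached? v∈B s t v∉st
          ... | xᵤ , xᵤ∈X , xᵤ∉st , u~xᵤ | xᵥ , xᵥ∈X , xᵥ∉st , v~xᵥ =
            u~xᵤ ++ʷ X-connected (∣pair∣≤2 s t) xᵤ∈X xᵥ∈X xᵤ∉st xᵥ∉st ++ʷ sameComp-sym v~xᵥ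

  substitute : ∀ {A : Set} → Dec A → (z : Fin n) → ∃[ z′ ] ((z′ ∈ X ⊎ z′ ≡ z × ¬ A) × (z′ ≡ z ⊎ A))
  substitute (yes a) z = let (x , x∈X , _) = X-avoiding z z in x , inj₁ x∈X , inj₂ a
  substitute (no ¬a) z = z , inj₂ (refl , ¬a) , inj₁ refl

  module _ (c : Fin n) (c∉B : c ∉ B) where

    record Cut : Set where
      constructor cut
      field
        d a b : Fin n
        c~d : SameComp G B c d
        d∉ab : d ∉ pair a b
        d-cut : ¬ Reaches (pair a b) d
    open Cut

    Side : Cut → Fin n → Set
    Side κ = SameComp G (pair (a κ) (b κ)) (d κ)

    side? : ∀ κ z → Dec (Side κ z)
    side? κ = sameComp? (pair (a κ) (b κ)) (d κ)

    side-size : Cut → ℕ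
    side-size κ = ∣ subsetOf (side? κ) ∣

    side∉B : ∀ κ {z} → Side κ z → z ∉ B
    side∉B κ d~z z∈B with ∈-subsetOf⁻ attached? z∈B (a κ) (b κ) (end d~z)
    ... | x , x∈X , x∉ab , z~x = d-cut κ (x , x∈X , x∉ab , d~z ++ʷ z~x)

    side∌X : ∀ κ {x} → x ∈ X → ¬ Side κ x
    side∌X κ x∈X d~x = side∉B κ d~x (X⊆B x∈X)

    side⊆comp : ∀ κ {z} → Side κ z → SameComp G B c z
    side⊆comp κ d~z = c~d κ ++ʷ narrow d~z (side∉B κ)

    side-grows : ∀ κ κ′ {s} → (∀ {z} → Side κ z → Side κ′ z) → Side κ′ s → ¬ Side κ s →
                 side-size κ < side-size κ′
    side-grows κ κ′ Side⊆Side′ s∈Side′ s∉Side =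
      p⊂q⇒∣p∣<∣q∣ ( (λ z∈ → ∈-subsetOf⁺ (side? κ′) (Side⊆Side′ (∈-subsetOf⁻ (side? κ) z∈)))
                  , _ , ∈-subsetOf⁺ (side? κ′) s∈Side′ , λ s∈ → s∉Side (∈-subsetOf⁻ (side? κ) s∈))

    Closed : Cut → Set
    Closed κ = ∀ {v w} → Side κ v → E G v w → w ∉ B → Side κ w

    -- Every neighbour of the component of c is then one of a, b.
    closed⇒adhesion : ∀ κ → Closed κ → AtMost2 (NbrComp G B c)
    closed⇒adhesion κ closed p q r Np Nq Nr = pigeonhole (∈ab Np) (∈ab Nq) (∈ab Nr)
      where
        ∈ab : ∀ {p} → NbrComp G B c p → p ≡ a κ ⊎ p ≡ b κ
        ∈ab {p} Np@(_ , c′ , c~c′ , e) with p ∈? pair (a κ) (b κ)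
        ... | yes p∈ab = ∈-pair⁻ p∈ab
        ... | no p∉ab = ⊥-elim (side∉B κ (d~c′ ∷ʳʷ (e , p∉ab)) (nbrComp-∈ Np))
          where
            d~c′ : Side κ c′
            d~c′ = preserves (Side κ) (sameComp-sym (c~d κ) ++ʷ c~c′) (here (d∉ab κ))
                             (λ d~x _ e y∉B → closed d~x e y∉B)
        pigeonhole : ∀ {a b p q r : Fin n} → p ≡ a ⊎ p ≡ b → q ≡ a ⊎ q ≡ b → r ≡ a ⊎ r ≡ b →
                     p ≡ q ⊎ p ≡ r ⊎ q ≡ r
        pigeonhole (inj₁ refl) (inj₁ refl) _ = inj₁ refl
        pigeonhole (inj₂ refl) (inj₂ refl) _ = inj₁ refl
        pigeonhole (inj₁ refl) (inj₂ refl) (inj₁ refl) = inj₂ (inj₁ refl)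
        pigeonhole (inj₁ refl) (inj₂ refl) (inj₂ refl) = inj₂ (inj₂ refl)
        pigeonhole (inj₂ refl) (inj₁ refl) (inj₂ refl) = inj₂ (inj₁ refl)
        pigeonhole (inj₂ refl) (inj₁ refl) (inj₁ refl) = inj₂ (inj₂ refl)

    grow-fresh : ∀ κ {v s a′ b′} → Side κ v → E G v s → s ∉ B → ¬ Side κ s →
                 s ∉ pair a′ b′ → ¬ Reaches (pair a′ b′) s → ¬ Side κ a′ → ¬ Side κ b′ →
                 ∃[ κ′ ] (side-size κ < side-size κ′)
    grow-fresh κ {v} {s} {a′} {b′} d~v e s∉B s∉side s∉ab′ s-cut a′∉side b′∉side =
      κ′ , side-grows κ κ′ side⊆side′ (here s∉ab′) s∉side
      where
        κ′ : Cut
        κ′ = cut s a′ b′ (side⊆comp κ d~v ∷ʳʷ (e , s∉B)) s∉ab′ s-cut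
        avoids-ab′ : ∀ {z} → Side κ z → z ∉ pair a′ b′
        avoids-ab′ d~z z∈ab′ with ∈-pair⁻ z∈ab′
        ... | inj₁ refl = a′∉side d~z
        ... | inj₂ refl = b′∉side d~z
        side⊆side′ : ∀ {z} → Side κ z → Side κ′ z
        side⊆side′ d~z =
          step s∉ab′ (E-sym e) (narrow (sameComp-sym d~v ++ʷ d~z) (λ v~w → avoids-ab′ (d~v ++ʷ v~w)))

    -- With {a, b} = {s, r} and a′ on the side of κ, cut d off by {r, b′} instead, dropping r
    -- if it is on the side of s and b′ if it is on the side of d: the new side of d stays
    -- within the union of both old sides, hence away from X, and it gains s.
    grow-merged : ∀ κ {v s r a′ b′} → Side κ v → E G v s → s ∉ B → ¬ Side κ s →
                  r ∈ pair (a κ) (b κ) → pair (a κ) (b κ) ⊆ pair s r →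
                  s ∉ pair a′ b′ → ¬ Reaches (pair a′ b′) s → Side κ a′ →
                  ∃[ κ′ ] (side-size κ < side-size κ′)
    grow-merged κ {v} {s} {r} {a′} {b′} d~v e s∉B s∉side r∈ab ab⊆sr s∉ab′ s-cut a′∈side
      with substitute (sameComp? (pair a′ b′) s r) r | substitute (side? κ b′) b′
    ... | r′ , r′-ok , r′-kept | e′ , e′-ok , e′-kept =
      κ′ , side-grows κ κ′ side⊆side′ (side⊆side′ d~v ∷ʳʷ (e , s∉S′)) s∉side
      where
        S′ : Subset n
        S′ = pair r′ e′
        Side′ : Fin n → Set
        Side′ = SameComp G (pair a′ b′) s
        side′∌X : ∀ {x} → x ∈ X → ¬ Side′ x
        side′∌X {x} x∈X s~x with x ∈? pair a′ b′
        ... | yes x∈ab′ = end s~x x∈ab′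
        ... | no x∉ab′ = s-cut (x , x∈X , x∉ab′ , s~x)
        r′∉side : ¬ Side κ r′
        r′∉side = [ side∌X κ
                  , (λ (r′≡r , _) d~r′ → end d~r′ (subst (_∈ pair (a κ) (b κ)) (sym r′≡r) r∈ab)) ] r′-ok
        e′∉side : ¬ Side κ e′
        e′∉side = [ side∌X κ
                  , (λ (e′≡b′ , b′∉side) d~e′ → b′∉side (subst (Side κ) e′≡b′ d~e′)) ] e′-ok
        s≢r′ : s ≢ r′
        s≢r′ refl = [ (λ s∈X → s∉B (X⊆B s∈X))
                    , (λ (s≡r , r∉side′) → r∉side′ (subst Side′ s≡r (here s∉ab′))) ] r′-ok
        s≢e′ : s ≢ e′
        s≢e′ refl = [ (λ s∈X → s∉B (X⊆B s∈X))
                    , (λ (s≡b′ , _) → s∉ab′ (∈-pair⁺ (inj₂ s≡b′))) ] e′-ok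
        S′∌side : ∀ {z} → z ∈ S′ → ¬ Side κ z
        S′∌side z∈S′ = [ (λ { refl → r′∉side }) , (λ { refl → e′∉side }) ] (∈-pair⁻ z∈S′)
        s∉S′ : s ∉ S′
        s∉S′ = ∉-pair s≢r′ s≢e′
        stays : ∀ {x y} → Side κ x ⊎ Side′ x → x ∉ S′ → E G x y → y ∉ S′ → Side κ y ⊎ Side′ y
        stays {y = y} (inj₁ d~x) _ xy y∉S′ with y ∈? pair (a κ) (b κ)
        ... | no y∉ab = inj₁ (d~x ∷ʳʷ (xy , y∉ab))
        ... | yes y∈ab with ∈-pair⁻ (ab⊆sr y∈ab)
        ...   | inj₁ refl = inj₂ (here s∉ab′)
        ...   | inj₂ refl =
          inj₂ ([ (λ r′≡y → ⊥-elim (y∉S′ (∈-pair⁺ (inj₁ (sym r′≡y))))) , (λ s~y → s~y) ] r′-kept)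
        stays {y = y} (inj₂ s~x) _ xy y∉S′ with y ∈? pair a′ b′
        ... | no y∉ab′ = inj₂ (s~x ∷ʳʷ (xy , y∉ab′))
        ... | yes y∈ab′ with ∈-pair⁻ y∈ab′
        ...   | inj₁ refl = inj₁ a′∈side
        ...   | inj₂ refl =
          inj₁ ([ (λ e′≡y → ⊥-elim (y∉S′ (∈-pair⁺ (inj₂ (sym e′≡y))))) , (λ d~y → d~y) ] e′-kept)
        d-cut′ : ¬ Reaches S′ (d κ)
        d-cut′ (x , x∈X , _ , d~x) =
          [ side∌X κ x∈X , side′∌X x∈X ] (preserves _ d~x (inj₁ (here (d∉ab κ))) stays)
        κ′ : Cut
        κ′ = cut (d κ) r′ e′ (c~d κ) (λ d∈S′ → S′∌side d∈S′ (here (d∉ab κ))) d-cut′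
        side⊆side′ : ∀ {z} → Side κ z → Side κ′ z
        side⊆side′ d~z = narrow d~z (λ d~w w∈S′ → S′∌side w∈S′ d~w)

    grow : ∀ κ {v s} → Side κ v → E G v s → s ∉ B → ¬ Side κ s → ∃[ κ′ ] (side-size κ < side-size κ′)
    grow κ {v} {s} d~v e s∉B s∉side with s ∈? pair (a κ) (b κ)
    ... | no s∉ab = ⊥-elim (s∉side (d~v ∷ʳʷ (e , s∉ab)))
    ... | yes s∈ab with ∈-pair⇒other s∈ab | ∉B⇒detached s∉B
    ...   | r , r∈ab , ab⊆sr | a′ , b′ , s∉ab′ , s-cut with side? κ a′ | side? κ b′
    ...     | yes a′∈side | _ = grow-merged κ d~v e s∉B s∉side r∈ab ab⊆sr s∉ab′ s-cut a′∈side
    ...     | no _ | yes b′∈side =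
      grow-merged κ d~v e s∉B s∉side r∈ab ab⊆sr (subst (s ∉_) ab′≡b′a′ s∉ab′)
                  (subst (λ S → ¬ Reaches S s) ab′≡b′a′ s-cut) b′∈side
      where
        ab′≡b′a′ : pair a′ b′ ≡ pair b′ a′
        ab′≡b′a′ = ∪-comm ⁅ a′ ⁆ ⁅ b′ ⁆
    ...     | no a′∉side | no b′∉side = grow-fresh κ d~v e s∉B s∉side s∉ab′ s-cut a′∉side b′∉side

    closed-or-grows : ∀ κ → Closed κ ⊎ ∃[ κ′ ] (side-size κ < side-size κ′)
    closed-or-grows κ
      with any? (λ v → any? (λ w → side? κ v ×-dec E? v w ×-dec ¬? (w ∈? B) ×-dec ¬? (side? κ w)))
    ... | yes (v , w , d~v , e , w∉B , w∉side) = inj₂ (grow κ d~v e w∉B w∉side)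
    ... | no no-exit = inj₁ closed
      where
        closed : Closed κ
        closed {v} {w} d~v e w∉B with side? κ w
        ... | yes d~w = d~w
        ... | no w∉side = ⊥-elim (no-exit (v , w , d~v , e , w∉B , w∉side))

    adhesion-at-c : AtMost2 (NbrComp G B c)
    adhesion-at-c with ∉B⇒detached c∉B
    ... | a , b , c∉ab , c-cut =
      let (κ , closed) = bounded-ascent side-size n (λ κ → ∣p∣≤n (subsetOf (side? κ)))
                                        Closed closed-or-grows (cut c a b (here c∉B) c∉ab c-cut)
      in closed⇒adhesion κ closed

  proper-block : ProperBlock G B
  proper-block = torso-3-connected , adhesion-at-c

OneOf₄ : ∀ {n} → Fin n → Fin n → Fin n → Fin n → Fin n → Set
OneOf₄ a b c d x = x ≡ a ⊎ x ≡ b ⊎ x ≡ c ⊎ x ≡ d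

oneOf₄? : ∀ {n} (a b c d x : Fin n) → Dec (OneOf₄ a b c d x)
oneOf₄? a b c d x = x ≟ᶠ a ⊎-dec x ≟ᶠ b ⊎-dec x ≟ᶠ c ⊎-dec x ≟ᶠ d

oneOf₄-⊆ : ∀ {n} {a b c d : Fin n} {p} → a ∈ p → b ∈ p → c ∈ p → d ∈ p → ∀ {x} → OneOf₄ a b c d x → x ∈ p
oneOf₄-⊆ a∈p _ _ _ (inj₁ refl) = a∈p
oneOf₄-⊆ _ b∈p _ _ (inj₂ (inj₁ refl)) = b∈p
oneOf₄-⊆ _ _ c∈p _ (inj₂ (inj₂ (inj₁ refl))) = c∈p
oneOf₄-⊆ _ _ _ d∈p (inj₂ (inj₂ (inj₂ refl))) = d∈p

proper-block⇒inseparable-quadruple :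
  ∀ {n} (G : Graph n) {B b₁ b₂ b₃} → ProperBlock G B → b₁ ∈ B → b₂ ∈ B → b₃ ∈ B →
  ∃[ b₄ ] (b₄ ≢ b₁ × b₄ ≢ b₂ × b₄ ≢ b₃ ×
           (∀ S → ∣ S ∣ ≤ 2 → ¬ Separates G S (OneOf₄ b₁ b₂ b₃ b₄)))
proper-block⇒inseparable-quadruple G {B} {b₁} {b₂} {b₃} block b₁∈B b₂∈B b₃∈B
  with 3<∣p∣⇒∃-avoiding (proj₁ (proj₁ block)) (∣⁅x⁆∣≤1 b₃) b₁ b₂
... | b₄ , b₄∈B , b₄≢b₁ , b₄≢b₂ , b₄∉b₃ =
  b₄ , b₄≢b₁ , b₄≢b₂ , x∉⁅y⁆⇒x≢y b₄∉b₃ ,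
  λ S ∣S∣≤2 → ProperBlockInseparable.inseparable G B block S ∣S∣≤2
                ∘ Separates-mono G S (oneOf₄-⊆ b₁∈B b₂∈B b₃∈B b₄∈B)

inseparable-quadruple⇒proper-block :
  ∀ {n} (G : Graph n) {b₁ b₂ b₃ b₄ : Fin n} →
  b₁ ≢ b₂ → b₁ ≢ b₃ → b₁ ≢ b₄ → b₂ ≢ b₃ → b₂ ≢ b₄ → b₃ ≢ b₄ →
  (∀ S → ∣ S ∣ ≤ 2 → ¬ Separates G S (OneOf₄ b₁ b₂ b₃ b₄)) →
  ∃[ B ] (ProperBlock G B × b₁ ∈ B × b₂ ∈ B × b₃ ∈ B)
inseparable-quadruple⇒proper-block {n} G {b₁} {b₂} {b₃} {b₄}
  b₁≢b₂ b₁≢b₃ b₁≢b₄ b₂≢b₃ b₂≢b₄ b₃≢b₄ inseparable =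
  B , proper-block ,
  X⊆B (∈X (inj₁ refl)) , X⊆B (∈X (inj₂ (inj₁ refl))) , X⊆B (∈X (inj₂ (inj₂ (inj₁ refl))))
  where
    X : Subset n
    X = subsetOf (oneOf₄? b₁ b₂ b₃ b₄)
    ∈X : ∀ {x} → OneOf₄ b₁ b₂ b₃ b₄ x → x ∈ X
    ∈X = ∈-subsetOf⁺ (oneOf₄? b₁ b₂ b₃ b₄)
    open InseparableSetBlock G X
           (4≤∣p∣ (∈X (inj₁ refl)) (∈X (inj₂ (inj₁ refl))) (∈X (inj₂ (inj₂ (inj₁ refl))))
                  (∈X (inj₂ (inj₂ (inj₂ refl)))) b₁≢b₂ b₁≢b₃ b₁≢b₄ b₂≢b₃ b₂≢b₄ b₃≢b₄)
           (λ S ∣S∣≤2 → inseparable S ∣S∣≤2 ∘ Separates-mono G S (∈-subsetOf⁻ (oneOf₄? b₁ b₂ b₃ b₄)))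

lemma12 : ∀ {n} (G : Graph n) (b₁ b₂ b₃ : Fin n) →
    b₁ ≢ b₂ → b₁ ≢ b₃ → b₂ ≢ b₃ →
    (∃[ B ] (ProperBlock G B × b₁ ∈ B × b₂ ∈ B × b₃ ∈ B))
    ⇔
    (∃[ b₄ ] (b₄ ≢ b₁ × b₄ ≢ b₂ × b₄ ≢ b₃ ×
      (∀ (S : Subset n) → ∣ S ∣ ≤ 2 →
        ¬ Separates G S (λ x → x ≡ b₁ ⊎ x ≡ b₂ ⊎ x ≡ b₃ ⊎ x ≡ b₄))))
lemma12 G b₁ b₂ b₃ b₁≢b₂ b₁≢b₃ b₂≢b₃ = mk⇔
  (λ (B , block , b₁∈B , b₂∈B , b₃∈B) → proper-block⇒inseparable-quadruple G block b₁∈B b₂∈B b₃∈B)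
  (λ (b₄ , b₄≢b₁ , b₄≢b₂ , b₄≢b₃ , inseparable) →
     inseparable-quadruple⇒proper-block G b₁≢b₂ b₁≢b₃ (≢-sym b₄≢b₁) b₂≢b₃ (≢-sym b₄≢b₂) (≢-sym b₄≢b₃)
       inseparable)
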